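{- Let $K$ be any $k$-family on $[n]$. (i) For every $(k-1)$-subset $T=\{t_1<\dots<t_{k-1}\}$ of $[n]$, $d_K^{(k-1)}(T)=|\rho_{k-1}^{ -1}(t_1,\dots,t_{k-1})\cap\pi^{\mathrm{subf}}(K)|$. (i$'$) For every $i\in[n]$, $d_i(K)=|\rho_1^{ -1}(i)\cap\pi^{\mathrm{vert}}(K)|$. (ii) Letting $\pi=\pi^{\mathrm{subf}}(K)$ and $\lambda=\lambda(\pi)$, the following are equivalent: (a) $K$ is shifted, i.e. a componentwise order ideal of $\binom{[n]}{k}$; (b) $\pi^{\mathrm{subf}}(K)$ is a componentwise order ideal of $\binom{[n]}{k-1}\times[k,n]$; (b$'$) $\pi^{\mathrm{vert}}(K)$ is a componentwise order ideal of $\binom{[n-1]}{k-1}\times[1,n]$; (c) the sets $(f^{\mathrm{subf}}_j)^{ -1}(\lambda\cap\sigma^{\mathrm{subf}}_j)$ are all equal to $K$ for $j=1,2,\dots,k$.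
   Context: A $k$-family on $[n]$ is a collection of distinct $k$-subsets of $[n]$; $d_i(K)=|\{S\in K:i\in S\}|$, and for a $(k-1)$-set $T$, $d_K^{(k-1)}(T)=|\{S\in K: T\subset S\}|$. Identify a $k$-set $\{i_1<\dots<i_k\}\subseteq[n]$ with $(i_1,\dots,i_k)\in\mathbb{P}^k$, so $\binom{[n]}{k}=\{x\in\mathbb{P}^k:1\le x_1<\dots<x_k\le n\}$. Let $\binom{[n-1]}{k-1}\times[1,n]=\{x\in\mathbb{P}^k:1\le x_1<\dots<x_{k-1}\le n-1,\ 1\le x_k\le n\}$ and $\binom{[n]}{k-1}\times[k,n]=\{x\in\mathbb{P}^k:1\le x_1<\dots<x_{k-1}\le n,\ k\le x_k\le n\}$. For a subset $X\subseteq\mathbb{P}^k$, a componentwise order ideal of $X$ is $I\subseteq X$ such that $x\in I$, $y\in X$, $y\le x$ coordinatewise imply $y\in I$. For $j=1,\dots,k$ let $f_j(i_1,\dots,i_k)=(i_1,\dots,i_{j-1},i_{j+1},\dots,i_k,i_j)$ (so $f_k$ is the identity), $f^{\mathrm{vert}}_j(x)=f_j(x)+(0,\dots,0,-1,\dots,-1,0)$ with $j-1$ zeros followed by $k-j$ entries $-1$ and a final $0$, and $f^{\mathrm{subf}}_j(x)=f_j(x)+(0,\dots,0,k-j)$. Set $\sigma^{\mathrm{subf}}_k=\binom{[n]}{k}$ and for $j<k$, $\sigma^{\mathrm{subf}}_j=\{x\in\mathbb{P}^k:1\le x_1<\dots<x_{j-1}<x_k-(k-j)<x_j<\dots<x_{k-1}\le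 n\}$ (which equals $f^{\mathrm{subf}}_j(\binom{[n]}{k})$). Define $\pi^{\mathrm{vert}}(K)=\bigcup_{j=1}^k f^{\mathrm{vert}}_j(K)\subseteq\binom{[n-1]}{k-1}\times[1,n]$ and $\pi^{\mathrm{subf}}(K)=\bigcup_{j=1}^k f^{\mathrm{subf}}_j(K)\subseteq\binom{[n]}{k-1}\times[k,n]$. Let $\rho_{k-1}:\mathbb{R}^k\to\mathbb{R}^{k-1}$ and $\rho_1:\mathbb{R}^k\to\mathbb{R}$ be projections onto the first $k-1$ coordinates and the last coordinate. For $\pi\subseteq\binom{[n]}{k-1}\times[k,n]$, $\lambda(\pi)$ is the unique subset of $\binom{[n]}{k-1}\times[k,n]$ such that for each $(k-1)$-set $T$, $\rho_{k-1}^{ -1}(T)\cap\lambda(\pi)$ has the same cardinality $c$ as $\rho_{k-1}^{ -1}(T)\cap\pi$ and its $x_k$-coordinates are exactly $k,k+1,\dots,k+c-1$. $K$ is shifted if it is down-closed in the componentwise order on $k$-sets. -}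

module Defs where

open import Data.Nat using (ℕ; zero; suc; _+_; _∸_; _≤_; _<_; pred)
open import Data.Nat.Properties using (_≟_)
open import Data.Fin using (Fin; toℕ)
open import Data.List using (List; []; _∷_; map; concatMap; upTo; allFin; filter; length)
open import Data.List.Membership.Propositional using () renaming (_∈_ to _∈ₗ_)
open import Data.Vec using (Vec; []; _∷_; lookup; removeAt; insertAt; _∷ʳ_; init; last)
import Data.Vec.Properties as VecP
open import Data.Vec.Relation.Unary.All using (All; all?)
open import Data.Vec.Relation.Binary.Pointwise.Inductive using (Pointwise)
open import Data.Vec.Membership.Propositional using () renaming (_∈_ to _∈ᵥ_)
open import Data.Product using (_×_)
open import Relation.Binary.PropositionalEquality using (_≡_)
open import Relation.Binary using (DecidableEquality)
open import Relation.Nullary using (Dec; _×-dec_)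
import Data.List.Membership.DecPropositional as LDec
import Data.Vec.Membership.DecPropositional as VDec

-- Points of ℙ^k are vectors (x₁,…,x_k) : Vec ℕ k ; subsets of ℙ^k are
-- predicates on Vec ℕ k.  A k-set {i₁<…<i_k} is the strictly increasing
-- vector (i₁,…,i_k).

Point : ℕ → Set
Point k = Vec ℕ k

SubsetP : ℕ → Set₁
SubsetP k = Point k → Set

_≟ᵥ_ : ∀ {k} → DecidableEquality (Point k)
_≟ᵥ_ = VecP.≡-dec _≟_

Increasing : ∀ {k} → Point k → Set
Increasing {k} x = (i j : Fin k) → toℕ i Data.Nat.< toℕ j → lookup x i < lookup x j

InRange : ∀ {k} → ℕ → ℕ → Point k → Set
InRange a b x = All (λ c → (a ≤ c) × (c ≤ b)) x

Binom : (n k : ℕ) → SubsetP k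
Binom n k x = Increasing x × InRange 1 n x

VertBox : (n m : ℕ) → SubsetP (suc m)
VertBox n m x = Binom (n ∸ 1) m (init x) × (1 ≤ last x) × (last x ≤ n)

SubfBox : (n m : ℕ) → SubsetP (suc m)
SubfBox n m x = Binom n m (init x) × (suc m ≤ last x) × (last x ≤ n)

_≤ᶜ_ : ∀ {k} → Point k → Point k → Set
y ≤ᶜ x = Pointwise _≤_ y x

IsOrderIdeal : ∀ {k} → SubsetP k → SubsetP k → Set
IsOrderIdeal {k} X I =
  ((x : Point k) → I x → X x) ×
  ((x y : Point k) → I x → X y → y ≤ᶜ x → I y)

-- k-families: a duplicate-free list of k-sets (checked by hypotheses in
-- the statement); membership is list membership.

Family : ℕ → Set
Family k = List (Point k)

InFam : ∀ {k} → Family k → SubsetP k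
InFam K x = x ∈ₗ K

degree : ∀ {k} → Family k → ℕ → ℕ
degree K i = length (filter (λ S → VDec._∈?_ _≟_ i S) K)

codegree : ∀ {m} → Family (suc m) → Point m → ℕ
codegree K T = length (filter (λ S → all? (λ t → VDec._∈?_ _≟_ t S) T) K)

-- The maps f_j, f_j^vert, f_j^subf.  The index j ∈ {1,…,k} is
-- represented by j' : Fin k with j = toℕ j' + 1.  Here k = suc m.

f : ∀ {m} → Fin (suc m) → Point (suc m) → Point (suc m)
f j x = removeAt x j ∷ʳ lookup x j

decFrom : ∀ {l} → ℕ → Point l → Point l
decFrom zero    v       = Data.Vec.map pred v
decFrom (suc p) []      = []
decFrom (suc p) (a ∷ v) = a ∷ decFrom p v

-- f_j^vert(x) = f_j(x) + (0^{j-1}, (-1)^{k-j}, 0)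
fvert : ∀ {m} → Fin (suc m) → Point (suc m) → Point (suc m)
fvert j x = decFrom (toℕ j) (removeAt x j) ∷ʳ lookup x j

-- f_j^subf(x) = f_j(x) + (0,…,0,k-j)
fsubf : ∀ {m} → Fin (suc m) → Point (suc m) → Point (suc m)
fsubf {m} j x = removeAt x j ∷ʳ (lookup x j + (m ∸ toℕ j))

-- σ_j^subf = {x : 1 ≤ x₁ < … < x_{j-1} < x_k-(k-j) < x_j < … < x_{k-1} ≤ n}
-- (for j = k this is binom([n],k) itself, since then k-j = 0)
σsubf : (n m : ℕ) → Fin (suc m) → SubsetP (suc m)
σsubf n m j x = Binom n (suc m) (insertAt (init x) j (last x ∸ (m ∸ toℕ j)))

-- π^vert(K) = ⋃_j f_j^vert(K),  π^subf(K) = ⋃_j f_j^subf(K),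
-- given as lists enumerating their elements (possibly with repetition);
-- the sets are the list-membership predicates.

πvertL : ∀ {m} → Family (suc m) → List (Point (suc m))
πvertL {m} K = concatMap (λ j → map (fvert j) K) (allFin (suc m))

πsubfL : ∀ {m} → Family (suc m) → List (Point (suc m))
πsubfL {m} K = concatMap (λ j → map (fsubf j) K) (allFin (suc m))

πvert : ∀ {m} → Family (suc m) → SubsetP (suc m)
πvert K x = x ∈ₗ πvertL K

πsubf : ∀ {m} → Family (suc m) → SubsetP (suc m)
πsubf K x = x ∈ₗ πsubfL K

_∈π?_ : ∀ {k} (x : Point k) (L : List (Point k)) → Dec (x ∈ₗ L)
x ∈π? L = LDec._∈?_ _≟ᵥ_ x L

-- Cardinality of a decidable subset of [1,n]^k: count the points of the
-- box [1,n]^k belonging to it.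

range1 : ℕ → List ℕ
range1 n = map suc (upTo n)

box : ℕ → (k : ℕ) → List (Point k)
box n zero    = [] ∷ []
box n (suc k) = concatMap (λ a → map (a ∷_) (box n k)) (range1 n)

cardBox : ∀ {k} (n : ℕ) {P : SubsetP k} → ((x : Point k) → Dec (P x)) → ℕ
cardBox {k} n P? = length (filter P? (box n k))

fiberSubf : ∀ {m} (n : ℕ) → Family (suc m) → Point m → ℕ
fiberSubf n K T = cardBox n (λ x → (init x ≟ᵥ T) ×-dec (x ∈π? πsubfL K))

fiberVert : ∀ {m} (n : ℕ) → Family (suc m) → ℕ → ℕ
fiberVert n K i = cardBox n (λ x → (last x ≟ i) ×-dec (x ∈π? πvertL K))

-- λ(π) for π = π^subf(K): the points x of binom([n],k-1)×[k,n] whose last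
-- coordinate lies in k, k+1, …, k+c-1, where c = |ρ_{k-1}^{-1}(ρ_{k-1}x) ∩ π|.
λsubf : (n m : ℕ) → Family (suc m) → SubsetP (suc m)
λsubf n m K x = SubfBox n m x × (last x < suc m + fiberSubf n K (init x))

-- Write k = m + 1.  On binom([n],k) every f_j^subf and f_j^vert is injective jointly in (j, S),
-- reflects the componentwise order, and maps onto its target box: the preimage of a point
-- reinserts its last coordinate, with the shift undone, into the unique gap of the remaining
-- coordinates where it fits.  Counting the S ∈ K containing a fixed T (resp. i) through the unique
-- j with ρ_{k-1}(f_j S) = T (resp. ρ_1(f_j S) = i) gives (i) and (i′).  A point below f_j(S) is
-- f_a(R) for some R ≤ S, so shiftedness of K passes to π; conversely f_k is the identity; this
-- gives (b) and (b′).  For (c): the fibres of an order ideal π are initial segments of [k, n], so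
-- λ(π) = π and x ∈ K is read off from λ at f_j^subf(x); conversely the λ-condition survives
-- lowering one coordinate of S, and such single steps generate the componentwise order among
-- ascending vectors.

module Submission where

open import Defs
open import Data.Nat using (ℕ; zero; suc; _+_; _∸_; _≤_; _<_; z≤n; s≤s; s≤s⁻¹; pred; _≤?_; _<?_)
open import Data.Nat.Properties
open import Data.Nat.Solver using (module +-*-Solver)
open import Data.Fin using (Fin; zero; suc; toℕ; fromℕ)
import Data.Fin.Properties as Fin
open import Data.Vec as Vec using (Vec; []; _∷_; lookup; removeAt; insertAt; _∷ʳ_; init; last; _[_]≔_)
import Data.Vec.Properties as Vec
open import Data.Vec.Relation.Unary.All as Allᵛ using ([]; _∷_) renaming (All to Allᵛ)
import Data.Vec.Relation.Unary.All.Properties as Allᵛ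
open import Data.Vec.Relation.Binary.Pointwise.Inductive as Pointwise using ([]; _∷_)
open import Data.Vec.Membership.Propositional using () renaming (_∈_ to _∈ᵥ_)
open import Data.Vec.Membership.Propositional.Properties using (∈-lookup)
import Data.Vec.Relation.Unary.Any as Anyᵛ
import Data.Vec.Relation.Unary.Any.Properties as Anyᵛ
open import Data.List as List using (List; []; _∷_; length; filter; upTo; _++_)
open import Data.List.Properties using (length-++-sucʳ; length-upTo)
open import Data.List.Membership.Propositional using (_∈_)
open import Data.List.Membership.Propositional.Properties
  using (∈-∃++; ∈-++⁻; ∈-++⁺ˡ; ∈-++⁺ʳ; ∈-concatMap⁺; ∈-concatMap⁻; ∈-map⁺; ∈-map⁻; ∈-allFin; ∈-upTo⁺; ∈-upTo⁻; ∈-filter⁺; ∈-filter⁻)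
open import Data.List.Relation.Unary.All as All using (All)
open import Data.List.Relation.Unary.Any as Any using (here; there)
open import Data.List.Relation.Unary.AllPairs using ([]; _∷_)
open import Data.List.Relation.Unary.Unique.Propositional using (Unique)
import Data.List.Relation.Unary.Unique.Propositional.Properties as Unique
open import Data.Sum using (inj₁; inj₂)
open import Data.Product using (_×_; _,_; proj₁; proj₂; ∃; ∃₂)
open import Data.Unit using (⊤; tt)
open import Data.Empty using (⊥-elim)
open import Relation.Nullary using (¬_; yes; no; _×-dec_)
open import Relation.Unary using (Decidable)
open import Relation.Binary using (DecidableEquality; tri<; tri≈; tri>)
open import Relation.Binary.PropositionalEquality
open import Function using (id)
open import Function.Bundles using (_⇔_; mk⇔; Equivalence)

Allᵛ-removeAt : ∀ {A : Set} {m} {P : A → Set} (S : Vec A (suc m)) (j : Fin (suc m)) → Allᵛ P S → Allᵛ P (removeAt S j)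
Allᵛ-removeAt (x ∷ xs)     zero    (_ ∷ ps)  = ps
Allᵛ-removeAt (x ∷ y ∷ ys) (suc j) (p ∷ ps) = p ∷ Allᵛ-removeAt (y ∷ ys) j ps

Allᵛ-insertAt : ∀ {A : Set} {m} {P : A → Set} (T : Vec A m) (j : Fin (suc m)) {v} → Allᵛ P T → P v → Allᵛ P (insertAt T j v)
Allᵛ-insertAt T       zero    ps       p = p ∷ ps
Allᵛ-insertAt (t ∷ T) (suc j) (q ∷ ps) p = q ∷ Allᵛ-insertAt T j ps p

Allᵛ-∷ʳ : ∀ {A : Set} {m} {P : A → Set} {T : Vec A m} {c} → Allᵛ P T → P c → Allᵛ P (T ∷ʳ c)
Allᵛ-∷ʳ []       p = p ∷ []
Allᵛ-∷ʳ (q ∷ ps) p = q ∷ Allᵛ-∷ʳ ps p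

Allᵛ-update : ∀ {A : Set} {m} {P : A → Set} (S : Vec A m) (j : Fin m) {v} → Allᵛ P S → P v → Allᵛ P (S [ j ]≔ v)
Allᵛ-update (x ∷ S) zero    (_ ∷ ps) p = p ∷ ps
Allᵛ-update (x ∷ S) (suc j) (q ∷ ps) p = q ∷ Allᵛ-update S j ps p

init-∷ʳ-last : ∀ {A : Set} {m} (x : Vec A (suc m)) → init x ∷ʳ last x ≡ x
init-∷ʳ-last x = sym (proj₂ (proj₂ (Vec.initLast x)))

init-last-∷ʳ : ∀ {A : Set} {m} (P : Vec A m → A → Set) {T c} → P (init (T ∷ʳ c)) (last (T ∷ʳ c)) ⇔ P T c
init-last-∷ʳ P {T} {c} rewrite Vec.init-∷ʳ c T | Vec.last-∷ʳ c T = mk⇔ id id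

≤ᶜ-∷ʳ⁺ : ∀ {k} {ys xs : Vec ℕ k} {a b} → ys ≤ᶜ xs → a ≤ b → (ys ∷ʳ a) ≤ᶜ (xs ∷ʳ b)
≤ᶜ-∷ʳ⁺ []         a≤b = a≤b ∷ []
≤ᶜ-∷ʳ⁺ (y≤x ∷ le) a≤b = y≤x ∷ ≤ᶜ-∷ʳ⁺ le a≤b

≤ᶜ-∷ʳ⁻ : ∀ {k} (ys xs : Vec ℕ k) {a b} → (ys ∷ʳ a) ≤ᶜ (xs ∷ʳ b) → ys ≤ᶜ xs × a ≤ b
≤ᶜ-∷ʳ⁻ []       []       (a≤b ∷ [])  = [] , a≤b
≤ᶜ-∷ʳ⁻ (y ∷ ys) (x ∷ xs) (y≤x ∷ le) = let (le′ , a≤b) = ≤ᶜ-∷ʳ⁻ ys xs le in (y≤x ∷ le′) , a≤b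

removeAt-last-∷ʳ : ∀ {A : Set} {m} (S : Vec A (suc m)) → removeAt S (fromℕ m) ∷ʳ lookup S (fromℕ m) ≡ S
removeAt-last-∷ʳ (x ∷ [])     = refl
removeAt-last-∷ʳ (x ∷ y ∷ ys) = cong (x ∷_) (removeAt-last-∷ʳ (y ∷ ys))

removeAt-update : ∀ {A : Set} {m} (S : Vec A (suc m)) (j : Fin (suc m)) v → removeAt (S [ j ]≔ v) j ≡ removeAt S j
removeAt-update (x ∷ xs)     zero          v = refl
removeAt-update (x ∷ y ∷ ys) (suc zero)    v = refl
removeAt-update (x ∷ y ∷ ys) (suc (suc j)) v = cong (x ∷_) (removeAt-update (y ∷ ys) (suc j) v)

Ascending : ∀ {k} → ℕ → Vec ℕ k → Set
Ascending b []       = ⊤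
Ascending b (x ∷ xs) = b < x × Ascending x xs

ascending-weaken : ∀ {k b c} {xs : Vec ℕ k} → c ≤ b → Ascending b xs → Ascending c xs
ascending-weaken {xs = []}     _   _          = tt
ascending-weaken {xs = x ∷ xs} c≤b (b<x , xs↑) = ≤-<-trans c≤b b<x , xs↑

ascending⇒above : ∀ {k b} {xs : Vec ℕ k} → Ascending b xs → Allᵛ (b <_) xs
ascending⇒above {xs = []}     _           = []
ascending⇒above {xs = x ∷ xs} (b<x , xs↑) = b<x ∷ Allᵛ.map (<-trans b<x) (ascending⇒above xs↑)

increasing⇒ascending : ∀ {k x} {xs : Vec ℕ k} → Increasing (x ∷ xs) → Ascending x xs
increasing⇒ascending {xs = []}     _   = tt
increasing⇒ascending {xs = y ∷ ys} inc =
  inc zero (suc zero) (s≤s z≤n) , increasing⇒ascending (λ i j i<j → inc (suc i) (suc j) (s≤s i<j))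

ascending⇒increasing : ∀ {k b} {xs : Vec ℕ k} → Ascending b xs → Increasing xs
ascending⇒increasing {xs = x ∷ xs} (_ , xs↑) zero    (suc j) _         = Allᵛ.lookup⁺ (ascending⇒above xs↑) j
ascending⇒increasing {xs = x ∷ xs} (_ , xs↑) (suc i) (suc j) (s≤s i<j) = ascending⇒increasing xs↑ i j i<j

binom⇒ascending : ∀ {n k} {x : Vec ℕ k} → Binom n k x → Ascending 0 x
binom⇒ascending {x = []}     _                      = tt
binom⇒ascending {x = y ∷ ys} (inc , (1≤y , _) ∷ _) = 1≤y , increasing⇒ascending inc

binom⇒bounded : ∀ {n k} {x : Vec ℕ k} → Binom n k x → Allᵛ (_≤ n) x
binom⇒bounded (_ , range) = proj₂ (Allᵛ.unzip range)

ascending⇒binom : ∀ {n k} {x : Vec ℕ k} → Ascending 0 x → Allᵛ (_≤ n) x → Binom n k x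
ascending⇒binom x↑ x≤n = ascending⇒increasing x↑ , Allᵛ.zip (ascending⇒above x↑ , x≤n)

ascending-removeAt-injective : ∀ {m b} (S : Vec ℕ (suc m)) (i j : Fin (suc m)) → Ascending b S →
                               removeAt S i ≡ removeAt S j → i ≡ j
ascending-removeAt-injective (x ∷ xs)     zero    zero    _              _  = refl
ascending-removeAt-injective (x ∷ y ∷ ys) zero    (suc j) (_ , x<y , _) eq =
  ⊥-elim (<-irrefl (sym (proj₁ (Vec.∷-injective eq))) x<y)
ascending-removeAt-injective (x ∷ y ∷ ys) (suc i) zero    (_ , x<y , _) eq =
  ⊥-elim (<-irrefl (proj₁ (Vec.∷-injective eq)) x<y)
ascending-removeAt-injective (x ∷ y ∷ ys) (suc i) (suc j) (_ , S↑)      eq =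
  cong suc (ascending-removeAt-injective (y ∷ ys) i j S↑ (proj₂ (Vec.∷-injective eq)))

ascending-lookup-injective : ∀ {m b} (S : Vec ℕ m) (i j : Fin m) → Ascending b S →
                             lookup S i ≡ lookup S j → i ≡ j
ascending-lookup-injective (x ∷ xs) zero    zero    _        _  = refl
ascending-lookup-injective (x ∷ xs) zero    (suc j) (_ , S↑) eq = ⊥-elim (<-irrefl eq (Allᵛ.lookup⁺ (ascending⇒above S↑) j))
ascending-lookup-injective (x ∷ xs) (suc i) zero    (_ , S↑) eq = ⊥-elim (<-irrefl (sym eq) (Allᵛ.lookup⁺ (ascending⇒above S↑) i))
ascending-lookup-injective (x ∷ xs) (suc i) (suc j) (_ , S↑) eq = cong suc (ascending-lookup-injective xs i j S↑ eq)

ascending-room : ∀ {m n s} (S : Vec ℕ m) → Ascending s S → Allᵛ (_≤ n) S → s ≤ n → s + m ≤ n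
ascending-room {s = s} [] _ _ s≤n = subst (_≤ _) (sym (+-identityʳ s)) s≤n
ascending-room {m = suc m} {s = s} (x ∷ S) (s<x , S↑) (x≤n ∷ S≤n) _ =
  ≤-trans (≤-reflexive (+-suc s m)) (≤-trans (+-monoˡ-≤ m s<x) (ascending-room S S↑ S≤n x≤n))

⊆-∷-below : ∀ {p q s} {S : Vec ℕ q} (T : Vec ℕ p) → Allᵛ (_∈ᵥ (s ∷ S)) T → Allᵛ (s <_) T → Allᵛ (_∈ᵥ S) T
⊆-∷-below []      []                   []          = []
⊆-∷-below (t ∷ T) (Anyᵛ.here refl ∷ _) (s<t ∷ _)   = ⊥-elim (<-irrefl refl s<t)
⊆-∷-below (t ∷ T) (Anyᵛ.there t∈ ∷ T⊆) (_ ∷ s<T) = t∈ ∷ ⊆-∷-below T T⊆ s<T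

ascending-⊆⇒length-≤ : ∀ {p q c d} (T : Vec ℕ p) (S : Vec ℕ q) → Ascending c T → Ascending d S →
                       Allᵛ (_∈ᵥ S) T → p ≤ q
ascending-⊆⇒length-≤ []      S       _            _        _                     = z≤n
ascending-⊆⇒length-≤ (t ∷ T) []      _            _        (() ∷ _)
ascending-⊆⇒length-≤ (t ∷ T) (s ∷ S) (_ , T↑)     (_ , S↑) (Anyᵛ.here refl ∷ T⊆) =
  s≤s (ascending-⊆⇒length-≤ T S T↑ S↑ (⊆-∷-below T T⊆ (ascending⇒above T↑)))
ascending-⊆⇒length-≤ (t ∷ T) (s ∷ S) (c<t , T↑) (_ , S↑) (Anyᵛ.there t∈ ∷ T⊆) =
  m≤n⇒m≤1+n (ascending-⊆⇒length-≤ (t ∷ T) S (c<t , T↑) S↑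
               (⊆-∷-below (t ∷ T) (Anyᵛ.there t∈ ∷ T⊆) (s<t ∷ Allᵛ.map (<-trans s<t) (ascending⇒above T↑))))
  where s<t = Allᵛ.lookup (ascending⇒above S↑) t∈

ascending-⊆⇒≡ : ∀ {p c d} (T S : Vec ℕ p) → Ascending c T → Ascending d S → Allᵛ (_∈ᵥ S) T → T ≡ S
ascending-⊆⇒≡ []      []      _          _        _                     = refl
ascending-⊆⇒≡ (t ∷ T) (s ∷ S) (_ , T↑)   (_ , S↑) (Anyᵛ.here refl ∷ T⊆) =
  cong (s ∷_) (ascending-⊆⇒≡ T S T↑ S↑ (⊆-∷-below T T⊆ (ascending⇒above T↑)))
ascending-⊆⇒≡ (t ∷ T) (s ∷ S) (c<t , T↑) (_ , S↑) (Anyᵛ.there t∈ ∷ T⊆) =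
  ⊥-elim (<-irrefl refl (ascending-⊆⇒length-≤ (t ∷ T) S (c<t , T↑) S↑
    (⊆-∷-below (t ∷ T) (Anyᵛ.there t∈ ∷ T⊆) (s<t ∷ Allᵛ.map (<-trans s<t) (ascending⇒above T↑)))))
  where s<t = Allᵛ.lookup (ascending⇒above S↑) t∈

ascending-⊆⇒removeAt : ∀ {m c d} (T : Vec ℕ m) (S : Vec ℕ (suc m)) → Ascending c T → Ascending d S →
                       Allᵛ (_∈ᵥ S) T → ∃ λ j → removeAt S j ≡ T
ascending-⊆⇒removeAt []      (s ∷ [])     _          _        _                     = zero , refl
ascending-⊆⇒removeAt (t ∷ T) (s ∷ y ∷ ys) (_ , T↑)   (_ , S↑) (Anyᵛ.here refl ∷ T⊆) =
  let (j , eq) = ascending-⊆⇒removeAt T (y ∷ ys) T↑ S↑ (⊆-∷-below T T⊆ (ascending⇒above T↑)) in suc j , cong (s ∷_) eq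
ascending-⊆⇒removeAt (t ∷ T) (s ∷ S)      (c<t , T↑) (_ , S↑) (Anyᵛ.there t∈ ∷ T⊆) =
  zero , sym (ascending-⊆⇒≡ (t ∷ T) S (c<t , T↑) S↑
    (⊆-∷-below (t ∷ T) (Anyᵛ.there t∈ ∷ T⊆) (s<t ∷ Allᵛ.map (<-trans s<t) (ascending⇒above T↑))))
  where s<t = Allᵛ.lookup (ascending⇒above S↑) t∈

⊆⇔removeAt : ∀ {m} {T : Vec ℕ m} {S : Vec ℕ (suc m)} → Ascending 0 T → Ascending 0 S →
             Allᵛ (_∈ᵥ S) T ⇔ (∃ λ j → removeAt S j ≡ T)
⊆⇔removeAt {T = T} {S} T↑ S↑ = mk⇔ (ascending-⊆⇒removeAt T S T↑ S↑)
  (λ { (j , refl) → Allᵛ-removeAt S j (Allᵛ.lookup⁻ (λ i → ∈-lookup i S)) })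

∈⇔lookup : ∀ {k i} {S : Vec ℕ k} → i ∈ᵥ S ⇔ (∃ λ j → lookup S j ≡ i)
∈⇔lookup {S = S} = mk⇔ (λ i∈ → Anyᵛ.index i∈ , sym (Anyᵛ.lookup-index i∈)) (λ { (j , refl) → ∈-lookup j S })

-- Lowering the coordinates one at a time from the left keeps every intermediate vector ascending.
down-closed-by-steps : ∀ {p} (b : ℕ) (P : Vec ℕ p → Set) →
                       (∀ S j v → P S → Ascending b (S [ j ]≔ v) → v ≤ lookup S j → P (S [ j ]≔ v)) →
                       ∀ x y → P x → Ascending b y → Ascending b x → y ≤ᶜ x → P y
down-closed-by-steps b P step []       []       Px _          _        []            = Px
down-closed-by-steps b P step (x₀ ∷ x) (y₀ ∷ y) Px (b<y₀ , y↑) (_ , x↑) (y₀≤x₀ ∷ y≤x) =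
  down-closed-by-steps y₀ (λ S → P (y₀ ∷ S)) step′ x y Py₀x y↑ (ascending-weaken y₀≤x₀ x↑) y≤x
  where
  Py₀x : P (y₀ ∷ x)
  Py₀x = step (x₀ ∷ x) zero y₀ Px (b<y₀ , ascending-weaken y₀≤x₀ x↑) y₀≤x₀
  step′ : ∀ S j v → P (y₀ ∷ S) → Ascending y₀ (S [ j ]≔ v) → v ≤ lookup S j → P (y₀ ∷ (S [ j ]≔ v))
  step′ S j v PS S′↑ v≤ = step (y₀ ∷ S) (suc j) v PS (b<y₀ , S′↑) v≤

-- Gaps of an ascending vector

OpenGap : ∀ {m} → ℕ → Vec ℕ m → Fin (suc m) → ℕ → Set
OpenGap b []      zero    v = b < v
OpenGap b (t ∷ T) zero    v = b < v × v < t
OpenGap b (t ∷ T) (suc j) v = OpenGap t T j v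

openGap-lower : ∀ {m b} {T : Vec ℕ m} {j v} → Ascending b T → OpenGap b T j v → toℕ j + b < v
openGap-lower {T = []}    {zero}  _ b<v       = b<v
openGap-lower {T = t ∷ T} {zero}  _ (b<v , _) = b<v
openGap-lower {b = b} {T = t ∷ T} {suc j} (b<t , T↑) gap =
  ≤-<-trans (≤-trans (≤-reflexive (sym (+-suc (toℕ j) b))) (+-monoʳ-≤ (toℕ j) b<t)) (openGap-lower T↑ gap)

openGap-head : ∀ {p c u} (U : Vec ℕ p) → Ascending u U → c < u → OpenGap c U zero u
openGap-head []      _          c<u = c<u
openGap-head (x ∷ U) (u<x , _) c<u = c<u , u<x

ascending-removeAt : ∀ {m b} (S : Vec ℕ (suc m)) (j : Fin (suc m)) → Ascending b S →
                     Ascending b (removeAt S j) × OpenGap b (removeAt S j) j (lookup S j)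
ascending-removeAt (x ∷ [])     zero    (b<x , _)         = tt , b<x
ascending-removeAt (x ∷ y ∷ ys) zero    (b<x , x<y , ys↑) = (<-trans b<x x<y , ys↑) , (b<x , x<y)
ascending-removeAt (x ∷ y ∷ ys) (suc j) (b<x , S↑)        =
  let (T↑ , gap) = ascending-removeAt (y ∷ ys) j S↑ in (b<x , T↑) , gap

ascending-insertAt : ∀ {m b} (T : Vec ℕ m) (j : Fin (suc m)) {v} → Ascending b T → OpenGap b T j v →
                     Ascending b (insertAt T j v)
ascending-insertAt []      zero    _          b<v         = b<v , tt
ascending-insertAt (t ∷ T) zero    (_ , T↑)   (b<v , v<t) = b<v , v<t , T↑
ascending-insertAt (t ∷ T) (suc j) (b<t , T↑) gap         = b<t , ascending-insertAt T j T↑ gap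

openGap-find : ∀ {m b} (T : Vec ℕ m) (ρ : ℕ) → Ascending b T → b < ρ →
               ∃ λ (a : Fin (suc m)) → OpenGap b T a (toℕ a + ρ)
openGap-find []      ρ _          b<ρ = zero , b<ρ
openGap-find (t ∷ T) ρ (b<t , T↑) b<ρ with ρ <? t
... | yes ρ<t = zero , (b<ρ , ρ<t)
... | no  ρ≮t =
  let (a , gap) = openGap-find T (suc ρ) T↑ (s≤s (≮⇒≥ ρ≮t)) in
  suc a , subst (OpenGap t T a) (+-suc (toℕ a) ρ) gap

openGap-separated : ∀ {m b} (T : Vec ℕ m) (a c : Fin (suc m)) {v w} → Ascending b T →
                    OpenGap b T a v → OpenGap b T c w → toℕ a < toℕ c → v + (toℕ c ∸ toℕ a) < w
openGap-separated (t ∷ T) zero (suc c) {v} {w} (_ , T↑) (_ , v<t) gap _ =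
  ≤-<-trans (≤-trans (≤-reflexive (+-suc v (toℕ c)))
                     (≤-trans (+-monoˡ-≤ (toℕ c) v<t) (≤-reflexive (+-comm t (toℕ c)))))
            (openGap-lower T↑ gap)
openGap-separated (t ∷ T) (suc a) (suc c) (_ , T↑) gapᵃ gapᶜ (s≤s a<c) =
  openGap-separated T a c T↑ gapᵃ gapᶜ a<c

-- w + j ≤ v + a is w - a ≤ v - j without truncated subtraction: the comparison of the last
-- coordinates of f_a^subf and f_j^subf.
insertAt-≤ᶜ : ∀ {p b b′} (U T : Vec ℕ p) (a j : Fin (suc p)) {w v} → Ascending b U → Ascending b′ T →
              OpenGap b U a w → OpenGap b′ T j v → U ≤ᶜ T → w + toℕ j ≤ v + toℕ a →
              insertAt U a w ≤ᶜ insertAt T j v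
insertAt-≤ᶜ []      []      zero    zero    _ _ _ _ [] le = +-cancelʳ-≤ 0 _ _ le ∷ []
insertAt-≤ᶜ (u ∷ U) (t ∷ T) zero    zero    _ _ _ _ U≤T le = +-cancelʳ-≤ 0 _ _ le ∷ U≤T
insertAt-≤ᶜ (u ∷ U) (t ∷ T) zero    (suc j) {w} {v} (_ , U↑) (_ , T↑) (_ , w<u) gap (u≤t ∷ U≤T) _ =
  <⇒≤ (<-≤-trans w<u u≤t) ∷
  insertAt-≤ᶜ U T zero j (ascending-weaken (<⇒≤ w<u) U↑) T↑ (openGap-head U U↑ w<u) gap U≤T le′
  where
  le′ : u + toℕ j ≤ v + 0
  le′ = begin
    u + toℕ j  ≤⟨ +-monoˡ-≤ (toℕ j) u≤t ⟩
    t + toℕ j  ≡⟨ +-comm t (toℕ j) ⟩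
    toℕ j + t  ≤⟨ <⇒≤ (openGap-lower T↑ gap) ⟩
    v          ≡⟨ sym (+-identityʳ v) ⟩
    v + 0      ∎
    where open ≤-Reasoning
insertAt-≤ᶜ (u ∷ U) (t ∷ T) (suc a) zero    {w} {v} (_ , U↑) (_ , T↑) gap (_ , v<t) (u≤t ∷ U≤T) le =
  u≤v ∷ insertAt-≤ᶜ U T a zero U↑ (ascending-weaken (<⇒≤ v<t) T↑) gap (openGap-head T T↑ v<t) U≤T le′
  where
  u≤v : u ≤ v
  u≤v = +-cancelʳ-≤ (toℕ a) u v (s≤s⁻¹ (begin
    suc (u + toℕ a)  ≡⟨ cong suc (+-comm u (toℕ a)) ⟩
    suc (toℕ a + u)  ≤⟨ openGap-lower U↑ gap ⟩
    w                ≡⟨ sym (+-identityʳ w) ⟩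
    w + 0            ≤⟨ le ⟩
    v + suc (toℕ a)  ≡⟨ +-suc v (toℕ a) ⟩
    suc (v + toℕ a)  ∎))
    where open ≤-Reasoning
  le′ : w + 0 ≤ t + toℕ a
  le′ = ≤-trans le (≤-trans (≤-reflexive (+-suc v (toℕ a))) (+-monoˡ-≤ (toℕ a) v<t))
insertAt-≤ᶜ (u ∷ U) (t ∷ T) (suc a) (suc j) {w} {v} (_ , U↑) (_ , T↑) gap gap′ (u≤t ∷ U≤T) le =
  u≤t ∷ insertAt-≤ᶜ U T a j U↑ T↑ gap gap′ U≤T (s≤s⁻¹ (subst₂ _≤_ (+-suc w (toℕ j)) (+-suc v (toℕ a)) le))

incFrom : ∀ {l} → ℕ → Vec ℕ l → Vec ℕ l
incFrom zero    v       = Vec.map suc v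
incFrom (suc p) []      = []
incFrom (suc p) (a ∷ v) = a ∷ incFrom p v

decFrom-incFrom : ∀ {l} (p : ℕ) (U : Vec ℕ l) → decFrom p (incFrom p U) ≡ U
decFrom-incFrom zero    []      = refl
decFrom-incFrom zero    (u ∷ U) = cong (u ∷_) (decFrom-incFrom zero U)
decFrom-incFrom (suc p) []      = refl
decFrom-incFrom (suc p) (u ∷ U) = cong (u ∷_) (decFrom-incFrom p U)

decFrom-length : ∀ {l} (U : Vec ℕ l) → decFrom l U ≡ U
decFrom-length []      = refl
decFrom-length (a ∷ U) = cong (a ∷_) (decFrom-length U)

HalfOpenGap : ∀ {m} → ℕ → Vec ℕ m → Fin (suc m) → ℕ → Set
HalfOpenGap b []      zero    v = b < v
HalfOpenGap b (t ∷ T) zero    v = b < v × v ≤ t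
HalfOpenGap b (t ∷ T) (suc j) v = HalfOpenGap t T j v

halfOpenGap-lower : ∀ {m b} (U : Vec ℕ m) (a : Fin (suc m)) {i} → Ascending b U → HalfOpenGap b U a i → b < i
halfOpenGap-lower []      zero    _          b<i       = b<i
halfOpenGap-lower (u ∷ U) zero    _          (b<i , _) = b<i
halfOpenGap-lower (u ∷ U) (suc a) (b<u , U↑) gap       = <-trans b<u (halfOpenGap-lower U a U↑ gap)

halfOpenGap-head : ∀ {p u} (U : Vec ℕ p) → Ascending u U → HalfOpenGap u U zero (suc u)
halfOpenGap-head []      _         = ≤-refl
halfOpenGap-head (x ∷ U) (u<x , _) = ≤-refl , u<x

halfOpenGap-find : ∀ {m b} (U : Vec ℕ m) (i : ℕ) → Ascending b U → b < i → ∃ λ (a : Fin (suc m)) → HalfOpenGap b U a i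
halfOpenGap-find []      i _          b<i = zero , b<i
halfOpenGap-find (u ∷ U) i (b<u , U↑) b<i with i ≤? u
... | yes i≤u = zero , (b<i , i≤u)
... | no  i≰u = let (a , gap) = halfOpenGap-find U i U↑ (≰⇒> i≰u) in suc a , gap

halfOpenGap-unique : ∀ {m b} (U : Vec ℕ m) (a a′ : Fin (suc m)) {i} → Ascending b U →
                     HalfOpenGap b U a i → HalfOpenGap b U a′ i → a ≡ a′
halfOpenGap-unique []      zero    zero     _        _         _         = refl
halfOpenGap-unique (u ∷ U) zero    zero     _        _         _         = refl
halfOpenGap-unique (u ∷ U) zero    (suc a′) (_ , U↑) (_ , i≤u) gap′      = ⊥-elim (<⇒≱ (halfOpenGap-lower U a′ U↑ gap′) i≤u)
halfOpenGap-unique (u ∷ U) (suc a) zero     (_ , U↑) gap       (_ , i≤u) = ⊥-elim (<⇒≱ (halfOpenGap-lower U a U↑ gap) i≤u)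
halfOpenGap-unique (u ∷ U) (suc a) (suc a′) (_ , U↑) gap       gap′      = cong suc (halfOpenGap-unique U a a′ U↑ gap gap′)

ascending-map-pred : ∀ {k c} (W : Vec ℕ k) → Ascending (suc c) W → Ascending c (Vec.map pred W)
ascending-map-pred []          _          = tt
ascending-map-pred (suc w ∷ W) (c<w , W↑) = s≤s⁻¹ c<w , ascending-map-pred W W↑

ascending-map-suc : ∀ {k c} (U : Vec ℕ k) → Ascending c U → Ascending (suc c) (Vec.map suc U)
ascending-map-suc []      _          = tt
ascending-map-suc (x ∷ U) (c<x , U↑) = s≤s c<x , ascending-map-suc U U↑

map-suc-pred : ∀ {k c} (W : Vec ℕ k) → Ascending c W → Vec.map suc (Vec.map pred W) ≡ W
map-suc-pred []          _        = refl
map-suc-pred (suc w ∷ W) (_ , W↑) = cong (suc w ∷_) (map-suc-pred W W↑)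

decFrom-openGap : ∀ {m b} (W : Vec ℕ m) (j : Fin (suc m)) {v} → Ascending b W → OpenGap b W j v →
                  HalfOpenGap b (decFrom (toℕ j) W) j v × Ascending b (decFrom (toℕ j) W) ×
                  incFrom (toℕ j) (decFrom (toℕ j) W) ≡ W
decFrom-openGap []      zero    _          b<v         = b<v , tt , refl
decFrom-openGap (w ∷ W) zero    (b<w , W↑) (b<v , v<w) =
  (b<v , <⇒≤pred v<w) , ascending-map-pred (w ∷ W) (≤-<-trans b<v v<w , W↑) , map-suc-pred (w ∷ W) (b<w , W↑)
decFrom-openGap (w ∷ W) (suc j) (b<w , W↑) gap         =
  let (gap′ , W′↑ , inc∘dec) = decFrom-openGap W j W↑ gap in gap′ , (b<w , W′↑) , cong (w ∷_) inc∘dec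

ascending-insertAt-incFrom : ∀ {m b} (U : Vec ℕ m) (a : Fin (suc m)) {i} → Ascending b U → HalfOpenGap b U a i →
                             Ascending b (insertAt (incFrom (toℕ a) U) a i)
ascending-insertAt-incFrom []      zero    _          b<i         = b<i , tt
ascending-insertAt-incFrom (u ∷ U) zero    (_ , U↑)   (b<i , i≤u) = b<i , s≤s i≤u , ascending-map-suc U U↑
ascending-insertAt-incFrom (u ∷ U) (suc a) (b<u , U↑) gap         = b<u , ascending-insertAt-incFrom U a U↑ gap

insertAt-incFrom-≤ᶜ : ∀ {p b b′} (U T : Vec ℕ p) (a j : Fin (suc p)) {i v} → Ascending b U → Ascending b′ T →
                      HalfOpenGap b U a i → HalfOpenGap b′ T j v → U ≤ᶜ T → i ≤ v →
                      insertAt (incFrom (toℕ a) U) a i ≤ᶜ insertAt (incFrom (toℕ j) T) j v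
insertAt-incFrom-≤ᶜ []      []      zero    zero    _ _ _ _ [] i≤v = i≤v ∷ []
insertAt-incFrom-≤ᶜ (u ∷ U) (t ∷ T) zero    zero    _ _ _ _ U≤T i≤v = i≤v ∷ Pointwise.map⁺ s≤s U≤T
insertAt-incFrom-≤ᶜ (u ∷ U) (t ∷ T) zero    (suc j) (_ , U↑) (_ , T↑) (_ , i≤u) gap (u≤t ∷ U≤T) _ =
  ≤-trans i≤u u≤t ∷
  insertAt-incFrom-≤ᶜ U T zero j U↑ T↑ (halfOpenGap-head U U↑) gap U≤T (≤-<-trans u≤t (halfOpenGap-lower T j T↑ gap))
insertAt-incFrom-≤ᶜ (u ∷ U) (t ∷ T) (suc a) zero    (_ , U↑) (_ , T↑) gap (_ , v≤t) (u≤t ∷ U≤T) i≤v =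
  <⇒≤ (<-≤-trans (halfOpenGap-lower U a U↑ gap) i≤v) ∷
  insertAt-incFrom-≤ᶜ U T a zero U↑ T↑ gap (halfOpenGap-head T T↑) U≤T (m≤n⇒m≤1+n (≤-trans i≤v v≤t))
insertAt-incFrom-≤ᶜ (u ∷ U) (t ∷ T) (suc a) (suc j) (_ , U↑) (_ , T↑) gap gap′ (u≤t ∷ U≤T) i≤v =
  u≤t ∷ insertAt-incFrom-≤ᶜ U T a j U↑ T↑ gap gap′ U≤T i≤v

length-≤-by-injection : ∀ {A B : Set} (R : A → B → Set) {xs : List A} {ys : List B} → Unique xs →
                        (∀ {x} → x ∈ xs → ∃ λ y → y ∈ ys × R x y) →
                        (∀ {x x′ y} → x ∈ xs → x′ ∈ xs → R x y → R x′ y → x ≡ x′) →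
                        length xs ≤ length ys
length-≤-by-injection R {[]}     _               _     _         = z≤n
length-≤-by-injection R {x ∷ xs} (x∉xs ∷ xs!) total injective with total (here refl)
... | y , y∈ys , xRy with ∈-∃++ y∈ys
... | ys₁ , ys₂ , refl =
  subst (suc (length xs) ≤_) (sym (length-++-sucʳ ys₁ y ys₂))
        (s≤s (length-≤-by-injection R xs! total′ (λ p q → injective (there p) (there q))))
  where
  total′ : ∀ {x′} → x′ ∈ xs → ∃ λ y′ → y′ ∈ ys₁ ++ ys₂ × R x′ y′
  total′ x′∈ with total (there x′∈)
  ... | y′ , y′∈ , x′Ry′ with ∈-++⁻ ys₁ y′∈
  ... | inj₁ p           = y′ , ∈-++⁺ˡ p , x′Ry′
  ... | inj₂ (here refl) = ⊥-elim (All.lookup x∉xs x′∈ (injective (here refl) (there x′∈) xRy x′Ry′))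
  ... | inj₂ (there p)   = y′ , ∈-++⁺ʳ ys₁ p , x′Ry′

length-≡-by-correspondence : ∀ {A B : Set} (R : A → B → Set) {xs : List A} {ys : List B} → Unique xs → Unique ys →
                             (∀ {x} → x ∈ xs → ∃ λ y → y ∈ ys × R x y) →
                             (∀ {y} → y ∈ ys → ∃ λ x → x ∈ xs × R x y) →
                             (∀ {x x′ y} → x ∈ xs → x′ ∈ xs → R x y → R x′ y → x ≡ x′) →
                             (∀ {x y y′} → x ∈ xs → y ∈ ys → y′ ∈ ys → R x y → R x y′ → y ≡ y′) →
                             length xs ≡ length ys
length-≡-by-correspondence R xs! ys! forth back injective functional = ≤-antisym
  (length-≤-by-injection R xs! forth injective)
  (length-≤-by-injection (λ y x → x ∈ _ × R x y) ys!
     (λ y∈ → let (x , x∈ , xRy) = back y∈ in x , x∈ , x∈ , xRy)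
     (λ y∈ y′∈ (x∈ , xRy) (_ , xRy′) → functional x∈ y∈ y′∈ xRy xRy′))

concatMap-∷≡cartesianProduct : ∀ {k} (xs : List ℕ) (ys : List (Vec ℕ k)) →
                               List.concatMap (λ a → List.map (a ∷_) ys) xs ≡ List.cartesianProductWith _∷_ xs ys
concatMap-∷≡cartesianProduct []       ys = refl
concatMap-∷≡cartesianProduct (x ∷ xs) ys = cong (List.map (x ∷_) ys ++_) (concatMap-∷≡cartesianProduct xs ys)

box-unique : ∀ n k → Unique (box n k)
box-unique n zero    = All.[] ∷ []
box-unique n (suc k) = subst Unique (sym (concatMap-∷≡cartesianProduct (range1 n) (box n k)))
  (Unique.cartesianProductWith⁺ _∷_ Vec.∷-injective (Unique.map⁺ suc-injective (Unique.upTo⁺ n)) (box-unique n k))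

inRange⇒∈box : ∀ {n k} (x : Vec ℕ k) → InRange 1 n x → x ∈ box n k
inRange⇒∈box []            []                = here refl
inRange⇒∈box {n} {suc k} (suc a ∷ x) ((_ , a≤n) ∷ x∈) =
  ∈-concatMap⁺ (λ a → List.map (a ∷_) (box n k))
    (Any.map (λ { refl → ∈-map⁺ (suc a ∷_) (inRange⇒∈box x x∈) }) (∈-map⁺ suc (∈-upTo⁺ a≤n)))

-- The maps f_j^subf

lookup+room≤ : ∀ {m n b} (S : Vec ℕ (suc m)) → Ascending b S → Allᵛ (_≤ n) S → (j : Fin (suc m)) →
               lookup S j + (m ∸ toℕ j) ≤ n
lookup+room≤ (x ∷ S)     (_ , S↑) (x≤n ∷ S≤n) zero    = ascending-room S S↑ S≤n x≤n
lookup+room≤ (x ∷ y ∷ S) (_ , S↑) (_ ∷ S≤n)   (suc j) = lookup+room≤ (y ∷ S) S↑ S≤n j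

lookup+room> : ∀ {m} (S : Vec ℕ (suc m)) → Ascending 0 S → (j : Fin (suc m)) → m < lookup S j + (m ∸ toℕ j)
lookup+room> {m} S S↑ j = begin-strict
  m                         ≡⟨ sym (m∸n+n≡m (Fin.toℕ≤pred[n] j)) ⟩
  m ∸ toℕ j + toℕ j         <⟨ +-monoʳ-< (m ∸ toℕ j) j<S[j] ⟩
  m ∸ toℕ j + lookup S j    ≡⟨ +-comm (m ∸ toℕ j) (lookup S j) ⟩
  lookup S j + (m ∸ toℕ j)  ∎
  where
  open ≤-Reasoning
  j<S[j] : toℕ j < lookup S j
  j<S[j] = let (T↑ , gap) = ascending-removeAt S j S↑ in
           subst (_< lookup S j) (+-identityʳ (toℕ j)) (openGap-lower T↑ gap)

room-separated : ∀ {m a c v w} → a < c → c ≤ m → v + (c ∸ a) < w → v + (m ∸ a) < w + (m ∸ c)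
room-separated {m} {a} {c} {v} {w} a<c c≤m lt = begin-strict
  v + (m ∸ a)                ≡⟨ cong (v +_) (trans (cong (_∸ a) (sym (m+[n∸m]≡n c≤m))) (+-∸-comm (m ∸ c) (<⇒≤ a<c))) ⟩
  v + ((c ∸ a) + (m ∸ c))    ≡⟨ sym (+-assoc v (c ∸ a) (m ∸ c)) ⟩
  v + (c ∸ a) + (m ∸ c)      <⟨ +-monoˡ-< (m ∸ c) lt ⟩
  w + (m ∸ c)                ∎
  where open ≤-Reasoning

room-cancel : ∀ {m a j w v} → a ≤ m → j ≤ m → w + (m ∸ a) ≤ v + (m ∸ j) → w + j ≤ v + a
room-cancel {m} {a} {j} {w} {v} a≤m j≤m le = +-cancelʳ-≤ m (w + j) (v + a) (begin
  w + j + m                    ≡⟨ sym (regroup w a j a≤m) ⟩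
  w + (m ∸ a) + (a + j)        ≤⟨ +-monoˡ-≤ (a + j) le ⟩
  v + (m ∸ j) + (a + j)        ≡⟨ cong (v + (m ∸ j) +_) (+-comm a j) ⟩
  v + (m ∸ j) + (j + a)        ≡⟨ regroup v j a j≤m ⟩
  v + a + m                    ∎)
  where
  open ≤-Reasoning
  open +-*-Solver
  regroup : ∀ x c d → c ≤ m → x + (m ∸ c) + (c + d) ≡ x + d + m
  regroup x c d c≤m = trans (solve 4 (λ x e c d → x :+ e :+ (c :+ d) := x :+ d :+ (e :+ c)) refl x (m ∸ c) c d)
                            (cong (x + d +_) (m∸n+n≡m c≤m))

SubfBox-∷ʳ : ∀ {n m} {T : Vec ℕ m} {c} → SubfBox n m (T ∷ʳ c) ⇔ (Binom n m T × suc m ≤ c × c ≤ n)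
SubfBox-∷ʳ {n} {m} = init-last-∷ʳ (λ T c → Binom n m T × suc m ≤ c × c ≤ n)

binom-removeAt : ∀ {n m} {S : Vec ℕ (suc m)} (j : Fin (suc m)) → Binom n (suc m) S → Binom n m (removeAt S j)
binom-removeAt {S = S} j S∈ =
  ascending⇒binom (proj₁ (ascending-removeAt S j (binom⇒ascending S∈))) (Allᵛ-removeAt S j (binom⇒bounded S∈))

fsubf-SubfBox : ∀ {n m} {S : Vec ℕ (suc m)} (j : Fin (suc m)) → Binom n (suc m) S → SubfBox n m (fsubf j S)
fsubf-SubfBox {S = S} j S∈ = Equivalence.from SubfBox-∷ʳ
  (binom-removeAt j S∈ , lookup+room> S S↑ j , lookup+room≤ S S↑ (binom⇒bounded S∈) j)
  where S↑ = binom⇒ascending S∈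

fsubf-fromℕ : ∀ {m} (S : Vec ℕ (suc m)) → fsubf (fromℕ m) S ≡ S
fsubf-fromℕ {m} S rewrite Fin.toℕ-fromℕ m | n∸n≡0 m | +-identityʳ (lookup S (fromℕ m)) = removeAt-last-∷ʳ S

-- For j < j′ the removed entries lie in gaps j < j′ of the same vector, and their distance
-- exceeds the difference j′ - j of the added rooms.
fsubf-injective : ∀ {m b} {S S′ : Vec ℕ (suc m)} (j j′ : Fin (suc m)) → Ascending b S → Ascending b S′ →
                  fsubf j S ≡ fsubf j′ S′ → S ≡ S′
fsubf-injective {m} {b} {S} {S′} j j′ S↑ S′↑ eq
  with Vec.∷ʳ-injective (removeAt S j) (removeAt S′ j′) eq | ascending-removeAt S j S↑ | ascending-removeAt S′ j′ S′↑
... | T≡T′ , last≡ | T↑ , gap | _ , gap′ with <-cmp (toℕ j) (toℕ j′)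
... | tri< j<j′ _ _ = ⊥-elim (<-irrefl last≡
        (room-separated j<j′ (Fin.toℕ≤pred[n] j′) (openGap-separated _ j j′ T↑ gap (subst (λ T → OpenGap b T j′ _) (sym T≡T′) gap′) j<j′)))
... | tri> _ _ j′<j = ⊥-elim (<-irrefl (sym last≡)
        (room-separated j′<j (Fin.toℕ≤pred[n] j) (openGap-separated _ j′ j T↑ (subst (λ T → OpenGap b T j′ _) (sym T≡T′) gap′) gap j′<j)))
... | tri≈ _ j≡j′ _ with Fin.toℕ-injective j≡j′
... | refl = begin
  S                                    ≡⟨ sym (Vec.insertAt-removeAt S j) ⟩
  insertAt (removeAt S j) j (lookup S j)   ≡⟨ cong₂ (λ T v → insertAt T j v) T≡T′ (+-cancelʳ-≡ (m ∸ toℕ j) _ _ last≡) ⟩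
  insertAt (removeAt S′ j) j (lookup S′ j) ≡⟨ Vec.insertAt-removeAt S′ j ⟩
  S′                                   ∎
  where open ≡-Reasoning

fsubf-reflects-≤ᶜ : ∀ {m b} {R S : Vec ℕ (suc m)} (a j : Fin (suc m)) → Ascending b R → Ascending b S →
                    fsubf a R ≤ᶜ fsubf j S → R ≤ᶜ S
fsubf-reflects-≤ᶜ {R = R} {S} a j R↑ S↑ le =
  let (U↑ , gapR) = ascending-removeAt R a R↑
      (T↑ , gapS) = ascending-removeAt S j S↑
      (U≤T , last≤) = ≤ᶜ-∷ʳ⁻ (removeAt R a) (removeAt S j) le
  in subst₂ _≤ᶜ_ (Vec.insertAt-removeAt R a) (Vec.insertAt-removeAt S j)
       (insertAt-≤ᶜ _ _ a j U↑ T↑ gapR gapS U≤T (room-cancel (Fin.toℕ≤pred[n] a) (Fin.toℕ≤pred[n] j) last≤))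

fsubf-surjective : ∀ {n m} {y : Vec ℕ (suc m)} → SubfBox n m y → ∃₂ λ a R → Binom n (suc m) R × fsubf a R ≡ y
fsubf-surjective {n} {m} {y} (U∈ , m<d , d≤n)
  with openGap-find (init y) (last y ∸ m) (binom⇒ascending U∈) (m+n≤o⇒m≤o∸n 1 m<d)
... | a , gap = a , R , ascending⇒binom R↑ R≤n , fsubf-R
  where
  U : Point m
  U = init y
  d : ℕ
  d = last y
  w : ℕ
  w = toℕ a + (d ∸ m)
  R : Point (suc m)
  R = insertAt U a w
  w+room≡d : w + (m ∸ toℕ a) ≡ d
  w+room≡d = begin
    toℕ a + (d ∸ m) + (m ∸ toℕ a)    ≡⟨ cong (_+ (m ∸ toℕ a)) (+-comm (toℕ a) (d ∸ m)) ⟩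
    d ∸ m + toℕ a + (m ∸ toℕ a)      ≡⟨ +-assoc (d ∸ m) (toℕ a) (m ∸ toℕ a) ⟩
    d ∸ m + (toℕ a + (m ∸ toℕ a))    ≡⟨ cong (d ∸ m +_) (m+[n∸m]≡n (Fin.toℕ≤pred[n] a)) ⟩
    d ∸ m + m                        ≡⟨ m∸n+n≡m (<⇒≤ m<d) ⟩
    d                                ∎
    where open ≡-Reasoning
  R↑ : Ascending 0 R
  R↑ = ascending-insertAt U a (binom⇒ascending U∈) gap
  R≤n : Allᵛ (_≤ n) R
  R≤n = Allᵛ-insertAt U a (binom⇒bounded U∈) (≤-trans (m≤m+n w (m ∸ toℕ a)) (≤-trans (≤-reflexive w+room≡d) d≤n))
  fsubf-R : fsubf a R ≡ y
  fsubf-R = trans (cong₂ _∷ʳ_ (Vec.removeAt-insertAt U a w)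
                              (trans (cong (_+ (m ∸ toℕ a)) (Vec.insertAt-lookup U a w)) w+room≡d))
                  (init-∷ʳ-last y)

init-fsubf : ∀ {m} (j : Fin (suc m)) (S : Vec ℕ (suc m)) → init (fsubf j S) ≡ removeAt S j
init-fsubf {m} j S = Vec.init-∷ʳ (lookup S j + (m ∸ toℕ j)) (removeAt S j)

SubfBox⇒∈box : ∀ {n m} {y : Vec ℕ (suc m)} → SubfBox n m y → y ∈ box n (suc m)
SubfBox⇒∈box {n} {m} {y} (U∈ , m<d , d≤n) =
  subst (_∈ box n (suc m)) (init-∷ʳ-last y) (inRange⇒∈box _ (Allᵛ-∷ʳ (proj₂ U∈) (≤-trans (s≤s z≤n) m<d , d≤n)))

-- The maps f_j^vert

pred≡∸1 : ∀ n → pred n ≡ n ∸ 1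
pred≡∸1 zero    = refl
pred≡∸1 (suc n) = refl

positive-≤∸1⇒< : ∀ {u n} → 0 < u → u ≤ n ∸ 1 → u < n
positive-≤∸1⇒< {n = zero}  0<u u≤0 = ⊥-elim (<⇒≱ 0<u u≤0)
positive-≤∸1⇒< {n = suc n} _   u≤n = s≤s u≤n

decFrom-bounded : ∀ {m b n} (W : Vec ℕ m) (j : Fin (suc m)) {v} → Ascending b W → OpenGap b W j v →
                  Allᵛ (_≤ n) W → v ≤ n → Allᵛ (_≤ n ∸ 1) (decFrom (toℕ j) W)
decFrom-bounded {n = n} []      zero    _        _   _           _   = []
decFrom-bounded {n = n} (w ∷ W) zero    _        _   W≤n         _   =
  Allᵛ.map⁺ (Allᵛ.map (λ {x} x≤n → subst (pred x ≤_) (pred≡∸1 n) (pred-mono-≤ x≤n)) W≤n)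
decFrom-bounded {n = n} (w ∷ W) (suc j) (_ , W↑) gap (_ ∷ W≤n) v≤n =
  subst (w ≤_) (pred≡∸1 n) (<⇒≤pred (<-≤-trans (≤-<-trans (m≤n+m w (toℕ j)) (openGap-lower W↑ gap)) v≤n)) ∷
  decFrom-bounded W j W↑ gap W≤n v≤n

incFrom-bounded : ∀ {k n} (p : ℕ) {U : Vec ℕ k} → Allᵛ (_< n) U → Allᵛ (_≤ n) (incFrom p U)
incFrom-bounded zero    []           = []
incFrom-bounded zero    (u<n ∷ U<n) = u<n ∷ incFrom-bounded zero U<n
incFrom-bounded (suc p) []           = []
incFrom-bounded (suc p) (u<n ∷ U<n) = <⇒≤ u<n ∷ incFrom-bounded p U<n

VertBox-∷ʳ : ∀ {n m} {T : Vec ℕ m} {c} → VertBox n m (T ∷ʳ c) ⇔ (Binom (n ∸ 1) m T × 1 ≤ c × c ≤ n)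
VertBox-∷ʳ {n} {m} = init-last-∷ʳ (λ T c → Binom (n ∸ 1) m T × 1 ≤ c × c ≤ n)

fvert-VertBox : ∀ {n m} {S : Vec ℕ (suc m)} (j : Fin (suc m)) → Binom n (suc m) S → VertBox n m (fvert j S)
fvert-VertBox {S = S} j S∈ =
  let S↑ = binom⇒ascending S∈
      S≤n = binom⇒bounded S∈
      (W↑ , gap) = ascending-removeAt S j S↑
      (_ , U↑ , _) = decFrom-openGap _ j W↑ gap
  in Equivalence.from VertBox-∷ʳ
       ( ascending⇒binom U↑ (decFrom-bounded _ j W↑ gap (Allᵛ-removeAt S j S≤n) (Allᵛ.lookup⁺ S≤n j))
       , Allᵛ.lookup⁺ (ascending⇒above S↑) j , Allᵛ.lookup⁺ S≤n j)

fvert-fromℕ : ∀ {m} (S : Vec ℕ (suc m)) → fvert (fromℕ m) S ≡ S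
fvert-fromℕ {m} S rewrite Fin.toℕ-fromℕ m | decFrom-length (removeAt S (fromℕ m)) = removeAt-last-∷ʳ S

fvert-injective : ∀ {m b} {S S′ : Vec ℕ (suc m)} (j j′ : Fin (suc m)) → Ascending b S → Ascending b S′ →
                  fvert j S ≡ fvert j′ S′ → S ≡ S′
fvert-injective {b = b} {S} {S′} j j′ S↑ S′↑ eq
  with Vec.∷ʳ-injective (decFrom (toℕ j) (removeAt S j)) (decFrom (toℕ j′) (removeAt S′ j′)) eq
     | ascending-removeAt S j S↑ | ascending-removeAt S′ j′ S′↑
... | U≡U′ , v≡v′ | W↑ , gap | W′↑ , gap′
  with decFrom-openGap _ j W↑ gap | decFrom-openGap _ j′ W′↑ gap′
... | hgap , U↑ , inc∘dec | hgap′ , _ , inc∘dec′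
  with halfOpenGap-unique _ j j′ U↑ hgap (subst₂ (λ U v → HalfOpenGap b U j′ v) (sym U≡U′) (sym v≡v′) hgap′)
... | refl = begin
  S                                          ≡⟨ sym (Vec.insertAt-removeAt S j) ⟩
  insertAt (removeAt S j) j (lookup S j)     ≡⟨ cong₂ (λ W v → insertAt W j v) W≡W′ v≡v′ ⟩
  insertAt (removeAt S′ j) j (lookup S′ j)   ≡⟨ Vec.insertAt-removeAt S′ j ⟩
  S′                                         ∎
  where
  open ≡-Reasoning
  W≡W′ : removeAt S j ≡ removeAt S′ j
  W≡W′ = trans (sym inc∘dec) (trans (cong (incFrom (toℕ j)) U≡U′) inc∘dec′)

fvert-reflects-≤ᶜ : ∀ {m b} {R S : Vec ℕ (suc m)} (a j : Fin (suc m)) → Ascending b R → Ascending b S →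
                    fvert a R ≤ᶜ fvert j S → R ≤ᶜ S
fvert-reflects-≤ᶜ {R = R} {S} a j R↑ S↑ le =
  let (W↑ , gapR) = ascending-removeAt R a R↑
      (X↑ , gapS) = ascending-removeAt S j S↑
      (hgapR , U↑ , inc∘decR) = decFrom-openGap _ a W↑ gapR
      (hgapS , T↑ , inc∘decS) = decFrom-openGap _ j X↑ gapS
      (U≤T , last≤) = ≤ᶜ-∷ʳ⁻ (decFrom (toℕ a) (removeAt R a)) (decFrom (toℕ j) (removeAt S j)) le
  in subst₂ _≤ᶜ_ (trans (cong (λ W → insertAt W a (lookup R a)) inc∘decR) (Vec.insertAt-removeAt R a))
                 (trans (cong (λ W → insertAt W j (lookup S j)) inc∘decS) (Vec.insertAt-removeAt S j))
       (insertAt-incFrom-≤ᶜ _ _ a j U↑ T↑ hgapR hgapS U≤T last≤)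

fvert-surjective : ∀ {n m} {y : Vec ℕ (suc m)} → VertBox n m y → ∃₂ λ a R → Binom n (suc m) R × fvert a R ≡ y
fvert-surjective {n} {m} {y} (U∈ , 1≤i , i≤n) with halfOpenGap-find (init y) (last y) (binom⇒ascending U∈) 1≤i
... | a , gap = a , R , ascending⇒binom R↑ R≤n , fvert-R
  where
  U : Point m
  U = init y
  R : Point (suc m)
  R = insertAt (incFrom (toℕ a) U) a (last y)
  R↑ : Ascending 0 R
  R↑ = ascending-insertAt-incFrom U a (binom⇒ascending U∈) gap
  R≤n : Allᵛ (_≤ n) R
  R≤n = Allᵛ-insertAt _ a (incFrom-bounded (toℕ a) (Allᵛ.map (λ (0<u , u≤n-1) → positive-≤∸1⇒< 0<u u≤n-1) (proj₂ U∈))) i≤n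
  fvert-R : fvert a R ≡ y
  fvert-R = trans (cong₂ _∷ʳ_ (trans (cong (decFrom (toℕ a)) (Vec.removeAt-insertAt _ a (last y))) (decFrom-incFrom (toℕ a) U))
                              (Vec.insertAt-lookup _ a (last y)))
                  (init-∷ʳ-last y)

last-fvert : ∀ {m} (j : Fin (suc m)) (S : Vec ℕ (suc m)) → last (fvert j S) ≡ lookup S j
last-fvert j S = Vec.last-∷ʳ (lookup S j) (decFrom (toℕ j) (removeAt S j))

VertBox⇒∈box : ∀ {n m} {y : Vec ℕ (suc m)} → VertBox n m y → y ∈ box n (suc m)
VertBox⇒∈box {n} {m} {y} (U∈ , 1≤i , i≤n) =
  subst (_∈ box n (suc m)) (init-∷ʳ-last y)
    (inRange⇒∈box _ (Allᵛ-∷ʳ (Allᵛ.map (λ (1≤u , u≤n-1) → 1≤u , ≤-trans u≤n-1 (m∸n≤m n 1)) (proj₂ U∈)) (1≤i , i≤n)))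

πL : ∀ {m} → (Fin (suc m) → Point (suc m) → Point (suc m)) → Family (suc m) → List (Point (suc m))
πL {m} F K = List.concatMap (λ j → List.map (F j) K) (List.allFin (suc m))

π-∈⁺ : ∀ {m} (F : Fin (suc m) → Point (suc m) → Point (suc m)) {K : Family (suc m)} (j : Fin (suc m)) {S} →
       S ∈ K → F j S ∈ πL F K
π-∈⁺ F {K} j S∈K = ∈-concatMap⁺ (λ j → List.map (F j) K) (Any.map (λ { refl → ∈-map⁺ (F j) S∈K }) (∈-allFin j))

π-∈⁻ : ∀ {m} (F : Fin (suc m) → Point (suc m) → Point (suc m)) {K : Family (suc m)} {y} →
       y ∈ πL F K → ∃₂ λ j S → S ∈ K × y ≡ F j S
π-∈⁻ {m} F {K} y∈π with Any.satisfied (∈-concatMap⁻ (λ j → List.map (F j) K) {xs = List.allFin (suc m)} y∈π)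
... | j , y∈FK with ∈-map⁻ (F j) y∈FK
... | S , S∈K , y≡FS = j , S , S∈K , y≡FS

record IsProjection (n m : ℕ) (F : Fin (suc m) → Point (suc m) → Point (suc m)) (Box : SubsetP (suc m)) : Set where
  field
    image          : ∀ {S} j → Binom n (suc m) S → Box (F j S)
    surjective     : ∀ {y} → Box y → ∃₂ λ a R → Binom n (suc m) R × F a R ≡ y
    injective      : ∀ {S S′} j j′ → Binom n (suc m) S → Binom n (suc m) S′ → F j S ≡ F j′ S′ → S ≡ S′
    reflects-≤ᶜ    : ∀ {R S} a j → Binom n (suc m) R → Binom n (suc m) S → F a R ≤ᶜ F j S → R ≤ᶜ S
    fromℕ-identity : ∀ S → F (fromℕ m) S ≡ S

fsubf-isProjection : ∀ n m → IsProjection n m fsubf (SubfBox n m)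
fsubf-isProjection n m = record
  { image          = fsubf-SubfBox
  ; surjective     = fsubf-surjective
  ; injective      = λ j j′ S∈ S′∈ → fsubf-injective j j′ (binom⇒ascending S∈) (binom⇒ascending S′∈)
  ; reflects-≤ᶜ    = λ a j R∈ S∈ → fsubf-reflects-≤ᶜ a j (binom⇒ascending R∈) (binom⇒ascending S∈)
  ; fromℕ-identity = fsubf-fromℕ
  }

fvert-isProjection : ∀ n m → IsProjection n m fvert (VertBox n m)
fvert-isProjection n m = record
  { image          = fvert-VertBox
  ; surjective     = fvert-surjective
  ; injective      = λ j j′ S∈ S′∈ → fvert-injective j j′ (binom⇒ascending S∈) (binom⇒ascending S′∈)
  ; reflects-≤ᶜ    = λ a j R∈ S∈ → fvert-reflects-≤ᶜ a j (binom⇒ascending R∈) (binom⇒ascending S∈)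
  ; fromℕ-identity = fvert-fromℕ
  }

module Projection {n m} {F : Fin (suc m) → Point (suc m) → Point (suc m)} {Box : SubsetP (suc m)}
                  (isProjection : IsProjection n m F Box) {K : Family (suc m)} (K⊆ : All (Binom n (suc m)) K) where

  open IsProjection isProjection

  π∋⇒∈K : ∀ {x} j → Binom n (suc m) x → F j x ∈ πL F K → x ∈ K
  π∋⇒∈K j x∈ Fx∈π with π-∈⁻ F Fx∈π
  ... | j′ , S , S∈K , eq = subst (_∈ K) (sym (injective j j′ x∈ (All.lookup K⊆ S∈K) eq)) S∈K

  shifted⇔ideal : IsOrderIdeal (Binom n (suc m)) (InFam K) ⇔ IsOrderIdeal Box (λ x → x ∈ πL F K)
  shifted⇔ideal = mk⇔ to from
    where
    to : IsOrderIdeal (Binom n (suc m)) (InFam K) → IsOrderIdeal Box (λ x → x ∈ πL F K)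
    to (_ , shifted) = inBox , closed
      where
      inBox : ∀ x → x ∈ πL F K → Box x
      inBox x x∈π with π-∈⁻ F x∈π
      ... | j , S , S∈K , refl = image j (All.lookup K⊆ S∈K)
      closed : ∀ x y → x ∈ πL F K → Box y → y ≤ᶜ x → y ∈ πL F K
      closed x y x∈π y∈ y≤x with π-∈⁻ F x∈π | surjective y∈
      ... | j , S , S∈K , refl | a , R , R∈ , refl =
        π-∈⁺ F a (shifted S R S∈K R∈ (reflects-≤ᶜ a j R∈ (All.lookup K⊆ S∈K) y≤x))
    from : IsOrderIdeal Box (λ x → x ∈ πL F K) → IsOrderIdeal (Binom n (suc m)) (InFam K)
    from (_ , closed) = (λ _ → All.lookup K⊆) , shifted
      where
      shifted : ∀ x y → x ∈ K → Binom n (suc m) y → y ≤ᶜ x → y ∈ K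
      shifted x y x∈K y∈ y≤x = π∋⇒∈K (fromℕ m) y∈
        (closed (F (fromℕ m) x) (F (fromℕ m) y)
                (π-∈⁺ F (fromℕ m) x∈K) (image (fromℕ m) y∈)
                (subst₂ _≤ᶜ_ (sym (fromℕ-identity y)) (sym (fromℕ-identity x)) y≤x))

  fibre-count : ∀ {A : Set} (_≟ₐ_ : DecidableEquality A) (proj : Point (suc m) → A) (t : A) → Unique K →
                (∀ {y} → Box y → y ∈ box n (suc m)) →
                (∀ {S} j j′ → Binom n (suc m) S → proj (F j S) ≡ proj (F j′ S) → j ≡ j′) →
                {P : SubsetP (suc m)} (P? : Decidable P) → (∀ {S} → S ∈ K → P S ⇔ (∃ λ j → proj (F j S) ≡ t)) →
                length (filter P? K) ≡ length (filter (λ x → (proj x ≟ₐ t) ×-dec (x ∈π? πL F K)) (box n (suc m)))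
  fibre-count _≟ₐ_ proj t K! Box⊆box proj-injective P? P⇔ =
    length-≡-by-correspondence (λ S y → ∃ λ j → y ≡ F j S)
      (Unique.filter⁺ P? K!) (Unique.filter⁺ Q? (box-unique n (suc m))) forth back injective′ functional
    where
    Q? : Decidable (λ x → proj x ≡ t × x ∈ πL F K)
    Q? = λ x → (proj x ≟ₐ t) ×-dec (x ∈π? πL F K)
    forth : ∀ {S} → S ∈ filter P? K → ∃ λ y → y ∈ filter Q? (box n (suc m)) × ∃ λ j → y ≡ F j S
    forth S∈ with ∈-filter⁻ P? S∈
    ... | S∈K , PS with Equivalence.to (P⇔ S∈K) PS
    ... | j , proj≡t = F j _ , ∈-filter⁺ Q? (Box⊆box (image j (All.lookup K⊆ S∈K))) (proj≡t , π-∈⁺ F j S∈K) , j , refl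
    back : ∀ {y} → y ∈ filter Q? (box n (suc m)) → ∃ λ S → S ∈ filter P? K × ∃ λ j → y ≡ F j S
    back y∈ with ∈-filter⁻ Q? {xs = box n (suc m)} y∈
    ... | _ , proj≡t , y∈π with π-∈⁻ F y∈π
    ... | j , S , S∈K , refl = S , ∈-filter⁺ P? S∈K (Equivalence.from (P⇔ S∈K) (j , proj≡t)) , j , refl
    injective′ : ∀ {S S′ y} → S ∈ filter P? K → S′ ∈ filter P? K →
                 (∃ λ j → y ≡ F j S) → (∃ λ j → y ≡ F j S′) → S ≡ S′
    injective′ S∈ S′∈ (j , refl) (j′ , eq) =
      injective j j′ (All.lookup K⊆ (proj₁ (∈-filter⁻ P? S∈))) (All.lookup K⊆ (proj₁ (∈-filter⁻ P? S′∈))) eq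
    functional : ∀ {S y y′} → S ∈ filter P? K → y ∈ filter Q? (box n (suc m)) → y′ ∈ filter Q? (box n (suc m)) →
                 (∃ λ j → y ≡ F j S) → (∃ λ j → y′ ≡ F j S) → y ≡ y′
    functional S∈ y∈ y′∈ (j , refl) (j′ , refl)
      with proj-injective j j′ (All.lookup K⊆ (proj₁ (∈-filter⁻ P? S∈)))
             (trans (proj₁ (proj₂ (∈-filter⁻ Q? {xs = box n (suc m)} y∈)))
                    (sym (proj₁ (proj₂ (∈-filter⁻ Q? {xs = box n (suc m)} y′∈)))))
    ... | refl = refl

-- Degrees as fibre sizes

codegree≡fiberSubf : ∀ n m (K : Family (suc m)) → Unique K → All (Binom n (suc m)) K →
                     (T : Point m) → Binom n m T → codegree K T ≡ fiberSubf n K T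
codegree≡fiberSubf n m K K! K⊆ T T∈ =
  Projection.fibre-count (fsubf-isProjection n m) K⊆ _≟ᵥ_ init T K! SubfBox⇒∈box init-injective _ ⊆⇔init
  where
  init-injective : ∀ {S} j j′ → Binom n (suc m) S → init (fsubf j S) ≡ init (fsubf j′ S) → j ≡ j′
  init-injective {S} j j′ S∈ eq =
    ascending-removeAt-injective S j j′ (binom⇒ascending S∈) (trans (sym (init-fsubf j S)) (trans eq (init-fsubf j′ S)))
  ⊆⇔init : ∀ {S} → S ∈ K → Allᵛ (_∈ᵥ S) T ⇔ (∃ λ j → init (fsubf j S) ≡ T)
  ⊆⇔init {S} S∈K = mk⇔
    (λ T⊆S → let (j , eq) = Equivalence.to ⊆⇔ T⊆S in j , trans (init-fsubf j S) eq)
    (λ (j , eq) → Equivalence.from ⊆⇔ (j , trans (sym (init-fsubf j S)) eq))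
    where
    ⊆⇔ : Allᵛ (_∈ᵥ S) T ⇔ (∃ λ j → removeAt S j ≡ T)
    ⊆⇔ = ⊆⇔removeAt (binom⇒ascending T∈) (binom⇒ascending (All.lookup K⊆ S∈K))

degree≡fiberVert : ∀ n m (K : Family (suc m)) → Unique K → All (Binom n (suc m)) K → (i : ℕ) → degree K i ≡ fiberVert n K i
degree≡fiberVert n m K K! K⊆ i =
  Projection.fibre-count (fvert-isProjection n m) K⊆ _≟_ last i K! VertBox⇒∈box last-injective _ ∈⇔last
  where
  last-injective : ∀ {S} j j′ → Binom n (suc m) S → last (fvert j S) ≡ last (fvert j′ S) → j ≡ j′
  last-injective {S} j j′ S∈ eq =
    ascending-lookup-injective S j j′ (binom⇒ascending S∈) (trans (sym (last-fvert j S)) (trans eq (last-fvert j′ S)))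
  ∈⇔last : ∀ {S} → S ∈ K → i ∈ᵥ S ⇔ (∃ λ j → last (fvert j S) ≡ i)
  ∈⇔last {S} _ = mk⇔
    (λ i∈S → let (j , eq) = Equivalence.to ∈⇔lookup i∈S in j , trans (last-fvert j S) eq)
    (λ (j , eq) → Equivalence.from ∈⇔lookup (j , trans (sym (last-fvert j S)) eq))

-- Shiftedness through λ and σ

σsubf-fsubf : ∀ {n m} (j : Fin (suc m)) (x : Point (suc m)) → σsubf n m j (fsubf j x) ⇔ Binom n (suc m) x
σsubf-fsubf {n} {m} j x = mk⇔ (subst (Binom n (suc m)) reinsert) (subst (Binom n (suc m)) (sym reinsert))
  where
  open ≡-Reasoning
  room : ℕ
  room = m ∸ toℕ j
  reinsert : insertAt (init (fsubf j x)) j (last (fsubf j x) ∸ room) ≡ x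
  reinsert = begin
    insertAt (init (fsubf j x)) j (last (fsubf j x) ∸ room)   ≡⟨ cong₂ (λ T c → insertAt T j (c ∸ room))
                                                                       (Vec.init-∷ʳ _ (removeAt x j)) (Vec.last-∷ʳ _ (removeAt x j)) ⟩
    insertAt (removeAt x j) j (lookup x j + room ∸ room)      ≡⟨ cong (insertAt (removeAt x j) j) (m+n∸n≡m (lookup x j) room) ⟩
    insertAt (removeAt x j) j (lookup x j)                    ≡⟨ Vec.insertAt-removeAt x j ⟩
    x                                                         ∎

-- The fibres of an order ideal π of binom([n],k-1) × [k,n] are initial segments of [k,n],
-- hence λ(π) = π.
module IdealFibres {n m} {K : Family (suc m)} (ideal : IsOrderIdeal (SubfBox n m) (πsubf K)) where

  private
    fibre? : (T : Point m) → Decidable (λ x → init x ≡ T × x ∈ πsubfL K)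
    fibre? T x = (init x ≟ᵥ T) ×-dec (x ∈π? πsubfL K)

  fibre-lower : ∀ {y} → y ∈ πsubfL K → last y < suc m + fiberSubf n K (init y)
  fibre-lower {y} y∈π with proj₁ ideal y y∈π
  ... | T∈ , m<d , d≤n = s≤s (≤-trans (m≤n+m∸n d m) (+-monoʳ-≤ m (subst (_≤ fiberSubf n K T) (length-upTo (d ∸ m)) count)))
    where
    T : Point m
    T = init y
    d : ℕ
    d = last y
    count : length (upTo (d ∸ m)) ≤ fiberSubf n K T
    count = length-≤-by-injection (λ i z → z ≡ T ∷ʳ (suc m + i)) (Unique.upTo⁺ (d ∸ m)) below injective
      where
      below : ∀ {i} → i ∈ upTo (d ∸ m) → ∃ λ z → z ∈ filter (fibre? T) (box n (suc m)) × z ≡ T ∷ʳ (suc m + i)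
      below {i} i∈ = T ∷ʳ (suc m + i) , ∈-filter⁺ (fibre? T) z∈box (Vec.init-∷ʳ _ T , z∈π) , refl
        where
        1+m+i≤d : suc m + i ≤ d
        1+m+i≤d = ≤-trans (≤-reflexive (sym (+-suc m i))) (≤-trans (+-monoʳ-≤ m (∈-upTo⁻ i∈)) (≤-reflexive (m+[n∸m]≡n (<⇒≤ m<d))))
        z∈box : T ∷ʳ (suc m + i) ∈ box n (suc m)
        z∈box = inRange⇒∈box _ (Allᵛ-∷ʳ (proj₂ T∈) (s≤s z≤n , ≤-trans 1+m+i≤d d≤n))
        z∈π : T ∷ʳ (suc m + i) ∈ πsubfL K
        z∈π = proj₂ ideal y _ y∈π (Equivalence.from SubfBox-∷ʳ (T∈ , s≤s (m≤m+n m i) , ≤-trans 1+m+i≤d d≤n))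
                (subst (λ w → (T ∷ʳ (suc m + i)) ≤ᶜ w) (init-∷ʳ-last y) (≤ᶜ-∷ʳ⁺ (Pointwise.refl ≤-refl) 1+m+i≤d))
      injective : ∀ {i i′ z} → i ∈ upTo (d ∸ m) → i′ ∈ upTo (d ∸ m) → z ≡ T ∷ʳ (suc m + i) → z ≡ T ∷ʳ (suc m + i′) → i ≡ i′
      injective _ _ refl eq = +-cancelˡ-≡ (suc m) _ _ (Vec.∷ʳ-injectiveʳ T T eq)

  fibre-upper : ∀ {y} → SubfBox n m y → ¬ (y ∈ πsubfL K) → fiberSubf n K (init y) ≤ last y ∸ suc m
  fibre-upper {y} y∈Box y∉π = subst (fiberSubf n K T ≤_) (length-upTo (d ∸ suc m)) count
    where
    T : Point m
    T = init y
    d : ℕ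
    d = last y
    count : fiberSubf n K T ≤ length (upTo (d ∸ suc m))
    count = length-≤-by-injection (λ z i → last z ≡ suc m + i) (Unique.filter⁺ (fibre? T) (box-unique n (suc m))) below injective
      where
      below : ∀ {z} → z ∈ filter (fibre? T) (box n (suc m)) → ∃ λ i → i ∈ upTo (d ∸ suc m) × last z ≡ suc m + i
      below {z} z∈ with ∈-filter⁻ (fibre? T) {xs = box n (suc m)} z∈
      ... | _ , initz≡T , z∈π with proj₁ ideal z z∈π | last z <? d
      ... | _ , m<last , _ | yes last<d = last z ∸ suc m , ∈-upTo⁺ (∸-monoˡ-< last<d m<last) , sym (m+[n∸m]≡n m<last)
      ... | _ | no last≮d = ⊥-elim (y∉π (proj₂ ideal z y z∈π y∈Box y≤z))
        where
        y≤z : y ≤ᶜ z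
        y≤z = subst₂ _≤ᶜ_ (init-∷ʳ-last y) (trans (cong (_∷ʳ last z) (sym initz≡T)) (init-∷ʳ-last z))
                     (≤ᶜ-∷ʳ⁺ (Pointwise.refl ≤-refl) (≮⇒≥ last≮d))
      injective : ∀ {z z′ i} → z ∈ filter (fibre? T) (box n (suc m)) → z′ ∈ filter (fibre? T) (box n (suc m)) →
                  last z ≡ suc m + i → last z′ ≡ suc m + i → z ≡ z′
      injective {z} {z′} z∈ z′∈ eq eq′ = begin
        z                  ≡⟨ sym (init-∷ʳ-last z) ⟩
        init z ∷ʳ last z   ≡⟨ cong₂ _∷ʳ_ (trans (proj₁ (proj₂ (∈-filter⁻ (fibre? T) {xs = box n (suc m)} z∈)))
                                                (sym (proj₁ (proj₂ (∈-filter⁻ (fibre? T) {xs = box n (suc m)} z′∈)))))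
                                         (trans eq (sym eq′)) ⟩
        init z′ ∷ʳ last z′ ≡⟨ init-∷ʳ-last z′ ⟩
        z′                 ∎
        where open ≡-Reasoning

  π⇔λsubf : ∀ y → y ∈ πsubfL K ⇔ λsubf n m K y
  π⇔λsubf y = mk⇔ (λ y∈π → proj₁ ideal y y∈π , fibre-lower y∈π) from
    where
    from : λsubf n m K y → y ∈ πsubfL K
    from (y∈Box , d<fibre) with y ∈π? πsubfL K
    ... | yes y∈π = y∈π
    ... | no  y∉π = ⊥-elim (<-irrefl refl (≤-trans d<fibre (begin
      suc m + fiberSubf n K (init y)   ≤⟨ +-monoʳ-≤ (suc m) (fibre-upper y∈Box y∉π) ⟩
      suc m + (last y ∸ suc m)         ≡⟨ m+[n∸m]≡n (proj₁ (proj₂ y∈Box)) ⟩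
      last y                           ∎)))
      where open ≤-Reasoning

λsubf-∷ʳ : ∀ {n m} {K : Family (suc m)} {T : Point m} {c} →
           λsubf n m K (T ∷ʳ c) ⇔ ((Binom n m T × suc m ≤ c × c ≤ n) × c < suc m + fiberSubf n K T)
λsubf-∷ʳ {n} {m} {K} = init-last-∷ʳ (λ T c → (Binom n m T × suc m ≤ c × c ≤ n) × c < suc m + fiberSubf n K T)

module _ {n m} {K : Family (suc m)} (K⊆ : All (Binom n (suc m)) K) where

  open Projection (fsubf-isProjection n m) K⊆

  PreimagesOfλσEqualK : Set
  PreimagesOfλσEqualK = (j : Fin (suc m)) (x : Point (suc m)) → InFam K x ⇔ (λsubf n m K (fsubf j x) × σsubf n m j (fsubf j x))

  shifted⇒λσ : IsOrderIdeal (Binom n (suc m)) (InFam K) → PreimagesOfλσEqualK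
  shifted⇒λσ shifted j x = mk⇔
    (λ x∈K → Equivalence.to (π⇔λsubf _) (π-∈⁺ fsubf j x∈K) , Equivalence.from (σsubf-fsubf j x) (All.lookup K⊆ x∈K))
    (λ (λx , σx) → π∋⇒∈K j (Equivalence.to (σsubf-fsubf j x) σx) (Equivalence.from (π⇔λsubf _) λx))
    where open IdealFibres (Equivalence.to shifted⇔ideal shifted)

  -- The λ-condition at f_j^subf(S) only bounds the last coordinate from above, so it survives
  -- lowering S_j.
  λσ⇒shifted : PreimagesOfλσEqualK → IsOrderIdeal (Binom n (suc m)) (InFam K)
  λσ⇒shifted λσ = (λ _ → All.lookup K⊆) , λ x y x∈K y∈ y≤x →
    down-closed-by-steps 0 (_∈ K) lower x y x∈K (binom⇒ascending y∈) (binom⇒ascending (All.lookup K⊆ x∈K)) y≤x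
    where
    lower : ∀ S j v → S ∈ K → Ascending 0 (S [ j ]≔ v) → v ≤ lookup S j → (S [ j ]≔ v) ∈ K
    lower S j v S∈K S′↑ v≤Sⱼ with Equivalence.to λsubf-∷ʳ (proj₁ (Equivalence.to (λσ j S) S∈K))
    ... | (T∈ , _ , c≤n) , c<fibre = Equivalence.from (λσ j S′) (λS′ , Equivalence.from (σsubf-fsubf j S′) S′∈)
      where
      S′ : Point (suc m)
      S′ = S [ j ]≔ v
      S≤n : Allᵛ (_≤ n) S
      S≤n = binom⇒bounded (All.lookup K⊆ S∈K)
      S′∈ : Binom n (suc m) S′
      S′∈ = ascending⇒binom S′↑ (Allᵛ-update S j S≤n (≤-trans v≤Sⱼ (Allᵛ.lookup⁺ S≤n j)))
      c′≤c : lookup S′ j + (m ∸ toℕ j) ≤ lookup S j + (m ∸ toℕ j)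
      c′≤c = +-monoˡ-≤ (m ∸ toℕ j) (subst (_≤ lookup S j) (sym (Vec.lookup∘update j S v)) v≤Sⱼ)
      λS′ : λsubf n m K (fsubf j S′)
      λS′ = subst (λ T → λsubf n m K (T ∷ʳ (lookup S′ j + (m ∸ toℕ j)))) (sym (removeAt-update S j v))
              (Equivalence.from λsubf-∷ʳ ((T∈ , lookup+room> S′ S′↑ j , ≤-trans c′≤c c≤n) , ≤-<-trans c′≤c c<fibre))

proposition4p18 :
    (n m : ℕ) (K : Family (suc m)) →
    Unique K → All (Binom n (suc m)) K →
    ((T : Point m) → Binom n m T → codegree K T ≡ fiberSubf n K T)
    × ((i : ℕ) → 1 ≤ i → i ≤ n → degree K i ≡ fiberVert n K i)
    × ((IsOrderIdeal (Binom n (suc m)) (InFam K) ⇔ IsOrderIdeal (SubfBox n m) (πsubf K))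
       × (IsOrderIdeal (Binom n (suc m)) (InFam K) ⇔ IsOrderIdeal (VertBox n m) (πvert K))
       × (IsOrderIdeal (Binom n (suc m)) (InFam K)
          ⇔ ((j : Fin (suc m)) (x : Point (suc m)) →
             InFam K x ⇔ (λsubf n m K (fsubf j x) × σsubf n m j (fsubf j x)))))
proposition4p18 n m K K! K⊆ =
  codegree≡fiberSubf n m K K! K⊆ ,
  (λ i _ _ → degree≡fiberVert n m K K! K⊆ i) ,
  Projection.shifted⇔ideal (fsubf-isProjection n m) K⊆ ,
  Projection.shifted⇔ideal (fvert-isProjection n m) K⊆ ,
  mk⇔ (shifted⇒λσ K⊆) (λσ⇒shifted K⊆)
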